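{- Let $m$ and $M$ be two positive integers and let $S= s_1\cdots s_n$ be a minimal zero-sum sequence over $\llbracket -m,M \rrbracket$ containing at least one element which is distinct from both $-m$ and $M$. Then there is a permutation $\sigma$ of $\{ 1, \dots , n \}$ such that for every integer $k$ with $1\leq k \leq n$, $$\sum_{i=1}^k s_{\sigma (i)} \in \llbracket -(m-1),M-1 \rrbracket.$$ In particular, $|S| \leq m+M-1$.
   Context: A finite sequence of integers $S=s_1\cdots s_n$ is an unordered finite multiset of integers; $|S|=n$ is its length. $S$ is a zero-sum sequence if $\sum_{i=1}^n s_i=0$, and a minimal zero-sum sequence if moreover $\sum_{i\in I}s_i\neq 0$ for every non-empty proper subset $I\subsetneq\{1,\dots,n\}$. A sequence is over a set $A$ if all its elements lie in $A$. For integers $a\le b$, $\llbracket a,b\rrbracket$ denotes the set of integers $i$ with $a\le i\le b$. -}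

module Defs where

open import Data.Nat using (ℕ)
open import Data.Integer using (ℤ; _+_; _≤_; _-_; +_; -_; 0ℤ)
open import Data.Fin using (Fin; zero; suc)
open import Data.Vec using (Vec; []; _∷_; lookup)
open import Data.Bool using (Bool; true; false)
open import Data.Fin.Subset using (Subset; Nonempty; ⊥; ⊤; _∈_; inside; outside)
open import Data.Product using (_×_; ∃)
open import Relation.Binary.PropositionalEquality using (_≡_; _≢_)
open import Relation.Nullary using (¬_)

-- A sequence of length n is represented by a vector s : Vec ℤ n
-- (the order of the entries is irrelevant for all notions below).

sumV : ∀ {n} → Vec ℤ n → ℤ
sumV [] = 0ℤ
sumV (x ∷ xs) = x + sumV xs

sumSub : ∀ {n} → Vec ℤ n → Subset n → ℤ
sumSub [] [] = 0ℤ
sumSub (x ∷ xs) (outside ∷ I) = sumSub xs I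
sumSub (x ∷ xs) (inside ∷ I) = x + sumSub xs I

ZeroSum : ∀ {n} → Vec ℤ n → Set
ZeroSum s = sumV s ≡ 0ℤ

MinimalZeroSum : ∀ {n} → Vec ℤ n → Set
MinimalZeroSum {n} s =
  ZeroSum s ×
  ((I : Subset n) → Nonempty I → I ≢ ⊤ → sumSub s I ≢ 0ℤ)

_∈⟦_,_⟧ : ℤ → ℤ → ℤ → Set
x ∈⟦ a , b ⟧ = (a ≤ x) × (x ≤ b)

OverInterval : ∀ {n} → Vec ℤ n → ℤ → ℤ → Set
OverInterval {n} s a b = (i : Fin n) → lookup s i ∈⟦ a , b ⟧

partialSum : ∀ {n} → (Fin n → ℤ) → ℕ → ℤ
partialSum {Data.Nat.zero} f k = 0ℤ
partialSum {Data.Nat.suc n} f Data.Nat.zero = 0ℤ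
partialSum {Data.Nat.suc n} f (Data.Nat.suc k) = f zero + partialSum (λ i → f (suc i)) k

{-# OPTIONS --safe #-}
-- Begin with an entry of S other than -m and M; its value lies in ⟦-(m-1), M-1⟧.
-- While the running sum t is nonzero, the unused entries sum to -t, so one of them
-- has sign opposite to t, and adding it keeps the running sum in ⟦-(m-1), M-1⟧.
-- Minimality keeps t nonzero until every entry is used. For the length bound, two
-- partial sums P_k, P_k' with 0 ≤ k < k' < n differ by the sum of a nonempty proper
-- subsequence, so P_1, …, P_(n-1) are distinct nonzero points of ⟦-(m-1), M-1⟧.

module Submission where

open import Defs
open import Data.Nat using (ℕ; _≤_; _∸_; _+_)
open import Data.Integer using (ℤ; +_; -_)
open import Data.Fin using (Fin)
open import Data.Vec using (Vec; lookup)
open import Data.Fin.Permutation using (Permutation; _⟨$⟩ʳ_)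
open import Data.Product using (_×_; ∃; Σ)
open import Relation.Binary.PropositionalEquality using (_≢_)

import Data.Integer.Properties as ℤₚ
open import Algebra.Properties.AbelianGroup ℤₚ.+-0-abelianGroup using (identityʳ-unique; inverseʳ-unique)
open import Algebra.Properties.CommutativeSemigroup ℤₚ.+-commutativeSemigroup using (x∙yz≈y∙xz)
open import Data.Empty using (⊥-elim)
open import Data.Fin using (zero; suc; toℕ; fromℕ<; splitAt; join; punchIn)
import Data.Fin.Properties as Finₚ
open import Data.Fin.Permutation using (id; insert; remove; remove-insert; punchIn-permute)
open import Data.Fin.Subset using (Subset; Nonempty; ⊥; ⊤; ∣_∣; inside; outside)
open import Data.Fin.Subset.Properties using (∣⊥∣≡0; ∣⊤∣≡n)
open import Data.Integer.Base as ℤ using (-[1+_]; +[1+_]; 0ℤ; +≤+)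
open import Data.Nat using (zero; suc; _<_; z≤n; s≤s; z<s)
import Data.Nat.Properties as ℕₚ
open import Data.Product using (_,_; proj₁; proj₂)
open import Data.Sum using (_⊎_; inj₁; inj₂)
open import Data.Sum.Properties using (inj₁-injective; inj₂-injective)
open import Data.Vec using ([]; _∷_; insertAt; removeAt; here; there)
open import Data.Vec.Properties using (insertAt-punchIn; insertAt-removeAt)
open import Function.Definitions using (Injective)
open import Relation.Binary.Definitions using (tri<; tri≈; tri>)
open import Relation.Binary.PropositionalEquality using (_≡_; refl; sym; trans; cong; cong₂; subst; subst₂; module ≡-Reasoning)
open import Relation.Nullary using (yes; no)

private
  variable
    a b l n : ℕ

0<∣p∣⇒Nonempty : {p : Subset n} → 0 < ∣ p ∣ → Nonempty p
0<∣p∣⇒Nonempty {p = inside ∷ p} _ = zero , here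
0<∣p∣⇒Nonempty {p = outside ∷ p} 0<∣p∣ with 0<∣p∣⇒Nonempty 0<∣p∣
... | x , x∈p = suc x , there x∈p

∣insertAt-inside∣ : ∀ (J : Subset n) i → ∣ insertAt J i inside ∣ ≡ suc ∣ J ∣
∣insertAt-inside∣ J zero = refl
∣insertAt-inside∣ (inside ∷ J) (suc i) = cong suc (∣insertAt-inside∣ J i)
∣insertAt-inside∣ (outside ∷ J) (suc i) = ∣insertAt-inside∣ J i

∣insertAt-outside∣ : ∀ (J : Subset n) i → ∣ insertAt J i outside ∣ ≡ ∣ J ∣
∣insertAt-outside∣ J zero = refl
∣insertAt-outside∣ (inside ∷ J) (suc i) = cong suc (∣insertAt-outside∣ J i)
∣insertAt-outside∣ (outside ∷ J) (suc i) = ∣insertAt-outside∣ J i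

lookup-removeAt : ∀ (s : Vec ℤ (suc n)) i j → lookup (removeAt s i) j ≡ lookup s (punchIn i j)
lookup-removeAt s i j = begin
  lookup (removeAt s i) j                                       ≡⟨ insertAt-punchIn (removeAt s i) i (lookup s i) j ⟨
  lookup (insertAt (removeAt s i) i (lookup s i)) (punchIn i j) ≡⟨ cong (λ v → lookup v _) (insertAt-removeAt s i) ⟩
  lookup s (punchIn i j)                                        ∎
  where open ≡-Reasoning

sumV-insertAt : ∀ (r : Vec ℤ n) i v → sumV (insertAt r i v) ≡ v ℤ.+ sumV r
sumV-insertAt r zero v = refl
sumV-insertAt (x ∷ r) (suc i) v = trans (cong (ℤ._+_ x) (sumV-insertAt r i v)) (x∙yz≈y∙xz x v (sumV r))

sumSub-insertAt-inside : ∀ (r : Vec ℤ n) J i v → sumSub (insertAt r i v) (insertAt J i inside) ≡ v ℤ.+ sumSub r J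
sumSub-insertAt-inside r J zero v = refl
sumSub-insertAt-inside (x ∷ r) (outside ∷ J) (suc i) v = sumSub-insertAt-inside r J i v
sumSub-insertAt-inside (x ∷ r) (inside ∷ J) (suc i) v =
  trans (cong (ℤ._+_ x) (sumSub-insertAt-inside r J i v)) (x∙yz≈y∙xz x v (sumSub r J))

sumSub-insertAt-outside : ∀ (r : Vec ℤ n) J i v → sumSub (insertAt r i v) (insertAt J i outside) ≡ sumSub r J
sumSub-insertAt-outside r J zero v = refl
sumSub-insertAt-outside (x ∷ r) (outside ∷ J) (suc i) v = sumSub-insertAt-outside r J i v
sumSub-insertAt-outside (x ∷ r) (inside ∷ J) (suc i) v = cong (ℤ._+_ x) (sumSub-insertAt-outside r J i v)

sumV-removeAt : ∀ (s : Vec ℤ (suc n)) i → sumV s ≡ lookup s i ℤ.+ sumV (removeAt s i)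
sumV-removeAt s i =
  trans (cong sumV (sym (insertAt-removeAt s i))) (sumV-insertAt (removeAt s i) i (lookup s i))

sumSub-removeAt-inside : ∀ (s : Vec ℤ (suc n)) i J →
  sumSub s (insertAt J i inside) ≡ lookup s i ℤ.+ sumSub (removeAt s i) J
sumSub-removeAt-inside s i J = trans (cong (λ v → sumSub v _) (sym (insertAt-removeAt s i)))
  (sumSub-insertAt-inside (removeAt s i) J i (lookup s i))

sumSub-removeAt-outside : ∀ (s : Vec ℤ (suc n)) i J → sumSub s (insertAt J i outside) ≡ sumSub (removeAt s i) J
sumSub-removeAt-outside s i J = trans (cong (λ v → sumSub v _) (sym (insertAt-removeAt s i)))
  (sumSub-insertAt-outside (removeAt s i) J i (lookup s i))

OverInterval-removeAt : ∀ (s : Vec ℤ (suc n)) i {lo hi} → OverInterval s lo hi → OverInterval (removeAt s i) lo hi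
OverInterval-removeAt s i {lo} {hi} over j =
  subst (_∈⟦ lo , hi ⟧) (sym (lookup-removeAt s i j)) (over (punchIn i j))

sumSub-⊥ : ∀ (s : Vec ℤ n) → sumSub s ⊥ ≡ 0ℤ
sumSub-⊥ [] = refl
sumSub-⊥ (x ∷ s) = sumSub-⊥ s

partialSum-cong : ∀ {f g : Fin n → ℤ} → (∀ x → f x ≡ g x) → ∀ k → partialSum f k ≡ partialSum g k
partialSum-cong {zero} f≗g k = refl
partialSum-cong {suc n} f≗g zero = refl
partialSum-cong {suc n} f≗g (suc k) = cong₂ ℤ._+_ (f≗g zero) (partialSum-cong (λ x → f≗g (suc x)) k)

orderedPartialSum : Vec ℤ n → Permutation n n → ℕ → ℤ
orderedPartialSum s σ = partialSum (λ i → lookup s (σ ⟨$⟩ʳ i))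

orderedPartialSum-zero : ∀ (s : Vec ℤ n) σ → orderedPartialSum s σ 0 ≡ 0ℤ
orderedPartialSum-zero [] σ = refl
orderedPartialSum-zero (x ∷ s) σ = refl

orderedPartialSum-suc : ∀ (s : Vec ℤ (suc n)) σ k →
  orderedPartialSum s σ (suc k) ≡
  lookup s (σ ⟨$⟩ʳ zero) ℤ.+ orderedPartialSum (removeAt s (σ ⟨$⟩ʳ zero)) (remove zero σ) k
orderedPartialSum-suc s σ k = cong (ℤ._+_ (lookup s (σ ⟨$⟩ʳ zero))) (partialSum-cong next k)
  where
  next : ∀ x → lookup s (σ ⟨$⟩ʳ suc x) ≡ lookup (removeAt s (σ ⟨$⟩ʳ zero)) (remove zero σ ⟨$⟩ʳ x)
  next x = trans (cong (lookup s) (punchIn-permute σ zero x)) (sym (lookup-removeAt s _ _))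

orderedPartialSum-insert : ∀ (s : Vec ℤ (suc n)) i τ k →
  orderedPartialSum s (insert zero i τ) (suc k) ≡ lookup s i ℤ.+ orderedPartialSum (removeAt s i) τ k
orderedPartialSum-insert s i τ k =
  trans (orderedPartialSum-suc s (insert zero i τ) k)
    (cong (ℤ._+_ (lookup s i)) (partialSum-cong (λ x → cong (lookup (removeAt s i)) (remove-insert zero i τ x)) k))

∃-negative-entry : ∀ (r : Vec ℤ n) → sumV r ℤ.< 0ℤ → ∃ λ i → lookup r i ℤ.< 0ℤ
∃-negative-entry [] (ℤ.+<+ ())
∃-negative-entry (x ∷ r) sum<0 with x ℤₚ.<? 0ℤ
... | yes x<0 = zero , x<0
... | no x≮0 = let i , rᵢ<0 = ∃-negative-entry r (ℤₚ.≤-<-trans sumV-r≤sum sum<0) in suc i , rᵢ<0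
  where
  sumV-r≤sum : sumV r ℤ.≤ x ℤ.+ sumV r
  sumV-r≤sum = subst (ℤ._≤ x ℤ.+ sumV r) (ℤₚ.+-identityˡ (sumV r)) (ℤₚ.+-monoˡ-≤ (sumV r) (ℤₚ.≮⇒≥ x≮0))

∃-positive-entry : ∀ (r : Vec ℤ n) → 0ℤ ℤ.< sumV r → ∃ λ i → 0ℤ ℤ.< lookup r i
∃-positive-entry [] (ℤ.+<+ ())
∃-positive-entry (x ∷ r) 0<sum with 0ℤ ℤₚ.<? x
... | yes 0<x = zero , 0<x
... | no 0≮x = let i , 0<rᵢ = ∃-positive-entry r (ℤₚ.<-≤-trans 0<sum sum≤sumV-r) in suc i , 0<rᵢ
  where
  sum≤sumV-r : x ℤ.+ sumV r ℤ.≤ sumV r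
  sum≤sumV-r = subst (x ℤ.+ sumV r ℤ.≤_) (ℤₚ.+-identityˡ (sumV r)) (ℤₚ.+-monoˡ-≤ (sumV r) (ℤₚ.≮⇒≥ 0≮x))

greedy-step : ∀ (t : ℤ) (r : Vec ℤ l) → OverInterval r (- (+ suc a)) (+ suc b) →
  t ∈⟦ - (+ a) , + b ⟧ → t ≢ 0ℤ → t ℤ.+ sumV r ≡ 0ℤ → ∃ λ i → (t ℤ.+ lookup r i) ∈⟦ - (+ a) , + b ⟧
greedy-step {a = a} {b} t r over (-a≤t , t≤b) t≢0 closes = by-sign
  where
  sumV≡-t : sumV r ≡ - t
  sumV≡-t = inverseʳ-unique t (sumV r) closes

  from-positive : 0ℤ ℤ.< t → ∃ λ i → (t ℤ.+ lookup r i) ∈⟦ - (+ a) , + b ⟧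
  from-positive 0<t
    with i , rᵢ<0 ← ∃-negative-entry r (subst (ℤ._< 0ℤ) (sym sumV≡-t) (ℤₚ.neg-mono-< 0<t)) =
    i ,
    subst (ℤ._≤ t ℤ.+ lookup r i) (ℤₚ.1-[1+n]≡-n a) (ℤₚ.+-mono-≤ (ℤₚ.i<j⇒suc[i]≤j 0<t) (proj₁ (over i))) ,
    ℤₚ.≤-trans (ℤₚ.+-monoʳ-≤ t (ℤₚ.<⇒≤ rᵢ<0)) (subst (ℤ._≤ + b) (sym (ℤₚ.+-identityʳ t)) t≤b)

  from-negative : t ℤ.< 0ℤ → ∃ λ i → (t ℤ.+ lookup r i) ∈⟦ - (+ a) , + b ⟧
  from-negative t<0
    with i , 0<rᵢ ← ∃-positive-entry r (subst (0ℤ ℤ.<_) (sym sumV≡-t) (ℤₚ.neg-mono-< t<0)) =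
    i ,
    ℤₚ.≤-trans (subst (- (+ a) ℤ.≤_) (sym (ℤₚ.+-identityʳ t)) -a≤t) (ℤₚ.+-monoʳ-≤ t (ℤₚ.<⇒≤ 0<rᵢ)) ,
    ℤₚ.+-mono-≤ (ℤₚ.i<j⇒i≤pred[j] t<0) (proj₂ (over i))

  by-sign : ∃ λ i → (t ℤ.+ lookup r i) ∈⟦ - (+ a) , + b ⟧
  by-sign with ℤₚ.<-cmp t 0ℤ
  ... | tri< t<0 _ _ = from-negative t<0
  ... | tri≈ _ t≡0 _ = ⊥-elim (t≢0 t≡0)
  ... | tri> _ _ 0<t = from-positive 0<t

greedy-ordering : ∀ (t : ℤ) (r : Vec ℤ l) → OverInterval r (- (+ suc a)) (+ suc b) →
  t ∈⟦ - (+ a) , + b ⟧ → t ℤ.+ sumV r ≡ 0ℤ → (∀ J → ∣ J ∣ < l → t ℤ.+ sumSub r J ≢ 0ℤ) →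
  Σ (Permutation l l) λ τ → ∀ k → k ≤ l → (t ℤ.+ orderedPartialSum r τ k) ∈⟦ - (+ a) , + b ⟧
greedy-ordering {a = a} {b} t [] _ t∈ _ _ =
  id , λ _ _ → subst (_∈⟦ - (+ a) , + b ⟧) (sym (ℤₚ.+-identityʳ t)) t∈
greedy-ordering {suc l} {a} {b} t r over t∈ closes no-early-zero = insert zero i τ , in-range
  where
  t≢0 : t ≢ 0ℤ
  t≢0 t≡0 = no-early-zero ⊥ (subst (_< suc l) (sym (∣⊥∣≡0 (suc l))) z<s)
    (trans (cong (ℤ._+_ t) (sumSub-⊥ r)) (trans (ℤₚ.+-identityʳ t) t≡0))

  step = greedy-step t r over t∈ t≢0 closes
  i = proj₁ step
  t' = t ℤ.+ lookup r i
  r' = removeAt r i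

  regroup : ∀ x → t ℤ.+ (lookup r i ℤ.+ x) ≡ t' ℤ.+ x
  regroup x = sym (ℤₚ.+-assoc t (lookup r i) x)

  closes' : t' ℤ.+ sumV r' ≡ 0ℤ
  closes' = trans (sym (regroup _)) (trans (cong (ℤ._+_ t) (sym (sumV-removeAt r i))) closes)

  no-early-zero' : ∀ J → ∣ J ∣ < l → t' ℤ.+ sumSub r' J ≢ 0ℤ
  no-early-zero' J ∣J∣<l eq = no-early-zero (insertAt J i inside)
    (subst (_< suc l) (sym (∣insertAt-inside∣ J i)) (s≤s ∣J∣<l))
    (trans (cong (ℤ._+_ t) (sumSub-removeAt-inside r i J)) (trans (regroup _) eq))

  rest = greedy-ordering t' r' (OverInterval-removeAt r i over) (proj₂ step) closes' no-early-zero'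
  τ = proj₁ rest

  in-range : ∀ k → k ≤ suc l → (t ℤ.+ orderedPartialSum r (insert zero i τ) k) ∈⟦ - (+ a) , + b ⟧
  in-range zero _ = subst (_∈⟦ - (+ a) , + b ⟧) (sym (ℤₚ.+-identityʳ t)) t∈
  in-range (suc k) (s≤s k≤l) = subst (_∈⟦ - (+ a) , + b ⟧)
    (trans (sym (regroup _)) (cong (ℤ._+_ t) (sym (orderedPartialSum-insert r i τ k))))
    (proj₂ rest k k≤l)

orderedPartialSum-difference : ∀ (s : Vec ℤ n) σ {k k'} → k ≤ k' → k' ≤ n →
  ∃ λ J → k + ∣ J ∣ ≡ k' × orderedPartialSum s σ k ℤ.+ sumSub s J ≡ orderedPartialSum s σ k'
orderedPartialSum-difference [] σ z≤n z≤n = [] , refl , refl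
orderedPartialSum-difference {suc n} s σ {zero} {zero} _ _ =
  ⊥ , ∣⊥∣≡0 (suc n) , trans (ℤₚ.+-identityˡ (sumSub s ⊥)) (sumSub-⊥ s)
orderedPartialSum-difference s σ {zero} {suc k'} _ (s≤s k'≤n)
  with J , size , sum ← orderedPartialSum-difference (removeAt s (σ ⟨$⟩ʳ zero)) (remove zero σ) z≤n k'≤n
  = insertAt J i inside , trans (∣insertAt-inside∣ J i) (cong suc size) , (begin
    0ℤ ℤ.+ sumSub s (insertAt J i inside)   ≡⟨ ℤₚ.+-identityˡ _ ⟩
    sumSub s (insertAt J i inside)          ≡⟨ sumSub-removeAt-inside s i J ⟩
    lookup s i ℤ.+ sumSub r J               ≡⟨ cong (ℤ._+_ (lookup s i)) prefix ⟩
    lookup s i ℤ.+ orderedPartialSum r τ k' ≡⟨ orderedPartialSum-suc s σ k' ⟨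
    orderedPartialSum s σ (suc k')          ∎)
  where
  open ≡-Reasoning
  i = σ ⟨$⟩ʳ zero
  r = removeAt s i
  τ = remove zero σ
  prefix : sumSub r J ≡ orderedPartialSum r τ k'
  prefix = trans (sym (ℤₚ.+-identityˡ _))
    (trans (cong (ℤ._+ sumSub r J) (sym (orderedPartialSum-zero r τ))) sum)
orderedPartialSum-difference s σ {suc k} {suc k'} (s≤s k≤k') (s≤s k'≤n)
  with J , size , sum ← orderedPartialSum-difference (removeAt s (σ ⟨$⟩ʳ zero)) (remove zero σ) k≤k' k'≤n
  = insertAt J i outside , cong suc (trans (cong (_+_ k) (∣insertAt-outside∣ J i)) size) , (begin
    orderedPartialSum s σ (suc k) ℤ.+ sumSub s (insertAt J i outside)
      ≡⟨ cong₂ ℤ._+_ (orderedPartialSum-suc s σ k) (sumSub-removeAt-outside s i J) ⟩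
    (lookup s i ℤ.+ orderedPartialSum r τ k) ℤ.+ sumSub r J ≡⟨ ℤₚ.+-assoc (lookup s i) _ _ ⟩
    lookup s i ℤ.+ (orderedPartialSum r τ k ℤ.+ sumSub r J) ≡⟨ cong (ℤ._+_ (lookup s i)) sum ⟩
    lookup s i ℤ.+ orderedPartialSum r τ k'                 ≡⟨ orderedPartialSum-suc s σ k' ⟨
    orderedPartialSum s σ (suc k')                          ∎)
  where
  open ≡-Reasoning
  i = σ ⟨$⟩ʳ zero
  r = removeAt s i
  τ = remove zero σ

minimal⇒sumSub≢0 : ∀ (s : Vec ℤ n) → MinimalZeroSum s → ∀ J → 0 < ∣ J ∣ → ∣ J ∣ < n → sumSub s J ≢ 0ℤ
minimal⇒sumSub≢0 {n} s (_ , proper≢0) J 0<∣J∣ ∣J∣<n =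
  proper≢0 J (0<∣p∣⇒Nonempty 0<∣J∣) (λ J≡⊤ → ℕₚ.<-irrefl (trans (cong ∣_∣ J≡⊤) (∣⊤∣≡n n)) ∣J∣<n)

orderedPartialSum-distinct : ∀ (s : Vec ℤ n) → MinimalZeroSum s → ∀ σ {k k'} → k < k' → k' < n →
  orderedPartialSum s σ k ≢ orderedPartialSum s σ k'
orderedPartialSum-distinct {n} s minimal σ {k} {k'} k<k' k'<n eq
  with J , size , sum ← orderedPartialSum-difference s σ (ℕₚ.<⇒≤ k<k') (ℕₚ.<⇒≤ k'<n)
  = minimal⇒sumSub≢0 s minimal J 0<∣J∣ ∣J∣<n (identityʳ-unique _ _ (trans sum (sym eq)))
  where
  0<∣J∣ : 0 < ∣ J ∣
  0<∣J∣ = ℕₚ.+-cancelˡ-< k 0 ∣ J ∣ (subst₂ _<_ (sym (ℕₚ.+-identityʳ k)) (sym size) k<k')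
  ∣J∣<n : ∣ J ∣ < n
  ∣J∣<n = ℕₚ.≤-<-trans (ℕₚ.m≤n+m ∣ J ∣ k) (subst (_< n) (sym size) k'<n)

nonzeroCode : ∀ v → v ∈⟦ - (+ a) , + b ⟧ → v ≢ 0ℤ → Fin a ⊎ Fin b
nonzeroCode (+ zero) _ v≢0 = ⊥-elim (v≢0 refl)
nonzeroCode +[1+ c ] (_ , +≤+ c<b) _ = inj₂ (fromℕ< c<b)
nonzeroCode -[1+ c ] (-a≤v , _) _ = inj₁ (fromℕ< (ℤₚ.drop‿+≤+ (ℤₚ.neg-cancel-≤ -a≤v)))

nonzeroCode-injective : ∀ {v w} p q p' q' → nonzeroCode {a} {b} v p q ≡ nonzeroCode w p' q' → v ≡ w
nonzeroCode-injective {v = + zero} _ q _ _ _ = ⊥-elim (q refl)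
nonzeroCode-injective {w = + zero} _ _ _ q' _ = ⊥-elim (q' refl)
nonzeroCode-injective {v = +[1+ c ]} {+[1+ c' ]} (_ , +≤+ _) _ (_ , +≤+ _) _ e =
  cong +[1+_] (Finₚ.fromℕ<-injective c c' _ _ (inj₂-injective e))
nonzeroCode-injective {v = -[1+ c ]} { -[1+ c' ]} _ _ _ _ e =
  cong -[1+_] (Finₚ.fromℕ<-injective c c' _ _ (inj₁-injective e))
nonzeroCode-injective {v = +[1+ c ]} { -[1+ c' ]} (_ , +≤+ _) _ _ _ ()
nonzeroCode-injective {v = -[1+ c ]} {+[1+ c' ]} _ _ (_ , +≤+ _) _ ()

nonzero-injection⇒≤ : ∀ (f : Fin l → ℤ) → Injective _≡_ _≡_ f →
  (∀ x → f x ∈⟦ - (+ a) , + b ⟧) → (∀ x → f x ≢ 0ℤ) → l ≤ a + b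
nonzero-injection⇒≤ {a = a} {b} f f-injective range nonzero = Finₚ.injective⇒≤ code-injective
  where
  code : Fin _ → Fin (a + b)
  code x = join a b (nonzeroCode (f x) (range x) (nonzero x))
  code-injective : Injective _≡_ _≡_ code
  code-injective e = f-injective (nonzeroCode-injective _ _ _ _
    (trans (sym (Finₚ.splitAt-join a b _)) (trans (cong (splitAt a) e) (Finₚ.splitAt-join a b _))))

bounded-partialSums⇒length≤ : ∀ (s : Vec ℤ (suc l)) → MinimalZeroSum s → ∀ σ →
  (∀ k → 1 ≤ k → k ≤ l → orderedPartialSum s σ k ∈⟦ - (+ a) , + b ⟧) → l ≤ a + b
bounded-partialSums⇒length≤ {l} s minimal σ range =
  nonzero-injection⇒≤ P P-injective (λ x → range (suc (toℕ x)) (s≤s z≤n) (Finₚ.toℕ<n x)) P≢0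
  where
  P : Fin l → ℤ
  P x = orderedPartialSum s σ (suc (toℕ x))
  distinct : ∀ {k k'} → k < k' → k' < suc l → orderedPartialSum s σ k ≢ orderedPartialSum s σ k'
  distinct = orderedPartialSum-distinct s minimal σ
  P-injective : Injective _≡_ _≡_ P
  P-injective {x} {y} e with Finₚ.<-cmp x y
  ... | tri< x<y _ _ = ⊥-elim (distinct (s≤s x<y) (s≤s (Finₚ.toℕ<n y)) e)
  ... | tri≈ _ x≡y _ = x≡y
  ... | tri> _ _ y<x = ⊥-elim (distinct (s≤s y<x) (s≤s (Finₚ.toℕ<n x)) (sym e))
  P≢0 : ∀ x → P x ≢ 0ℤ
  P≢0 x e = distinct z<s (s≤s (Finₚ.toℕ<n x)) (sym e)

∈⟦⟧-shrink : ∀ {x} → x ∈⟦ - (+ suc a) , + suc b ⟧ → x ≢ - (+ suc a) → x ≢ + suc b → x ∈⟦ - (+ a) , + b ⟧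
∈⟦⟧-shrink {a} (lo , hi) x≢lo x≢hi =
  subst (ℤ._≤ _) (ℤₚ.1-[1+n]≡-n a) (ℤₚ.i<j⇒suc[i]≤j (ℤₚ.≤∧≢⇒< lo (λ e → x≢lo (sym e)))) ,
  ℤₚ.i<j⇒i≤pred[j] (ℤₚ.≤∧≢⇒< hi x≢hi)

lemma3p4 : (m M : ℕ) → 1 ≤ m → 1 ≤ M → (n : ℕ) → (s : Vec ℤ n) →
    MinimalZeroSum s →
    OverInterval s (- (+ m)) (+ M) →
    (∃ λ (j : Fin n) → (lookup s j ≢ - (+ m)) × (lookup s j ≢ + M)) →
    (Σ (Permutation n n) λ σ →
      (k : ℕ) → 1 ≤ k → k ≤ n →
        partialSum (λ i → lookup s (σ ⟨$⟩ʳ i)) k ∈⟦ - (+ (m ∸ 1)) , + (M ∸ 1) ⟧)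
    × (n ≤ m + M ∸ 1)
lemma3p4 (suc a) (suc b) _ _ zero s _ _ (() , _)
lemma3p4 (suc a) (suc b) _ _ (suc l) s minimal over (j , sⱼ≢-m , sⱼ≢M) =
  (σ , in-range) , length≤
  where
  no-early-zero : ∀ J → ∣ J ∣ < l → lookup s j ℤ.+ sumSub (removeAt s j) J ≢ 0ℤ
  no-early-zero J ∣J∣<l eq = minimal⇒sumSub≢0 s minimal (insertAt J j inside)
    (subst (0 <_) (sym (∣insertAt-inside∣ J j)) z<s)
    (subst (_< suc l) (sym (∣insertAt-inside∣ J j)) (s≤s ∣J∣<l))
    (trans (sumSub-removeAt-inside s j J) eq)

  ordering = greedy-ordering (lookup s j) (removeAt s j) (OverInterval-removeAt s j over)
    (∈⟦⟧-shrink (over j) sⱼ≢-m sⱼ≢M) (trans (sym (sumV-removeAt s j)) (proj₁ minimal)) no-early-zero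
  σ = insert zero j (proj₁ ordering)

  in-range : (k : ℕ) → 1 ≤ k → k ≤ suc l → orderedPartialSum s σ k ∈⟦ - (+ a) , + b ⟧
  in-range (suc k) _ (s≤s k≤l) =
    subst (_∈⟦ - (+ a) , + b ⟧) (sym (orderedPartialSum-insert s j (proj₁ ordering) k)) (proj₂ ordering k k≤l)

  length≤ : suc l ≤ a + suc b
  length≤ = subst (suc l ≤_) (sym (ℕₚ.+-suc a b)) (s≤s (bounded-partialSums⇒length≤ s minimal σ
    (λ k 1≤k k≤l → in-range k 1≤k (ℕₚ.m≤n⇒m≤1+n k≤l))))
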